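{- Let $M=(E,G)$ be a matroid and $F$ a flat of $G$. The following are equivalent: (1) $F$ has no mixed cosets with respect to $M$; (2) there is a flat $K$ of $G$ with $V(F)\cap V(K)=\{0\}$ and $V(F)+V(K)=V(G)$ such that $E=(E\cap F)\cup((E\cap K)+V(F))$ (i.e. $M$ is the lift-join of $M|F$ and the induced submatroid $M|K$); (3) for every maximal flat $J$ of $G$ disjoint from $F$, we have $E=(E\cap F)\cup((E\cap J)+V(F))$ (i.e. $M$ is the lift-join of $M|F$ and $M|J$).
   Context: A matroid is a pair $M=(E,G)$ where $G$ is the set of nonzero vectors of a finite-dimensional $\mathbb F_2$-vector space $V(G)=G\cup\{0\}$ and $E\subseteq G$. A flat of $G$ is a set $F\subseteq G$ such that $V(F):=F\cup\{0\}$ is a subspace (the empty set is a flat). $M|F=(E\cap F,F)$. For $X,Y\subseteq V(G)$, $X+Y=\{x+y:x\in X,y\in Y\}$. A coset of a flat $F$ is a set $x+V(F)$ with $x\in G\setminus F$; it is mixed (with respect to $M$) if it meets both $E$ and $G\setminus E$. The lift-join of $M_1=(E_1,G_1)$ and $M_2=(E_2,G_2)$ is $(E_1\cup(E_2+V(G_1)),G_1\oplus G_2)$ where $G_1\oplus G_2$ is the set of nonzero vectors of $V(G_1)\oplus V(G_2)$. -}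

module Defs where

open import Data.Bool using (Bool; true; false; _xor_)
open import Data.Nat using (ℕ)
open import Data.Vec using (Vec; zipWith; replicate)
open import Data.Product using (Σ; _×_; ∃; ∃-syntax; _,_)
open import Data.Sum using (_⊎_)
open import Data.Empty using (⊥)
open import Relation.Nullary using (¬_)
open import Relation.Binary.PropositionalEquality using (_≡_)
open import Function.Bundles using (_⇔_)

-- The ambient F₂-vector space V(G) is modelled as F₂ⁿ = Vec Bool n
-- (every finite-dimensional F₂-space is isomorphic to one of these).
Vect : ℕ → Set
Vect n = Vec Bool n

_⊕_ : {n : ℕ} → Vect n → Vect n → Vect n
_⊕_ = zipWith _xor_

infixl 6 _⊕_

𝟎 : {n : ℕ} → Vect n
𝟎 {n} = replicate n false

-- Subsets of V(G), decidable (membership is a Bool); finite so no loss.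
Subset : ℕ → Set
Subset n = Vect n → Bool

_∈_ : {n : ℕ} → Vect n → Subset n → Set
x ∈ S = S x ≡ true

infix 4 _∈_

InG : {n : ℕ} → Vect n → Set
InG x = ¬ (x ≡ 𝟎)

InV : {n : ℕ} → Subset n → Vect n → Set
InV S x = x ≡ 𝟎 ⊎ x ∈ S

-- F is a flat of G: F ⊆ G and V(F) is a subspace
-- (over F₂ a subspace = subset containing 0 closed under +).
IsFlat : {n : ℕ} → Subset n → Set
IsFlat F = (¬ (𝟎 ∈ F)) × (∀ x y → InV F x → InV F y → InV F (x ⊕ y))

-- A matroid M = (E, G) with G = F₂ⁿ ∖ {0} and E ⊆ G.
record Matroid (n : ℕ) : Set where
  field
    E   : Subset n
    E⊆G : ¬ (𝟎 ∈ E)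
open Matroid public

InCoset : {n : ℕ} → Subset n → Vect n → Vect n → Set
InCoset F x y = ∃[ f ] (InV F f × y ≡ x ⊕ f)

IsMixedCoset : {n : ℕ} → Matroid n → Subset n → Vect n → Set
IsMixedCoset M F x =
  (InG x × ¬ (x ∈ F))
  × (∃[ y ] (InCoset F x y × y ∈ E M))
  × (∃[ y ] (InCoset F x y × InG y × ¬ (y ∈ E M)))

NoMixedCosets : {n : ℕ} → Matroid n → Subset n → Set
NoMixedCosets M F = ∀ x → ¬ IsMixedCoset M F x

IsLiftJoinOf : {n : ℕ} → Matroid n → Subset n → Subset n → Set
IsLiftJoinOf M F K =
  ∀ x → (x ∈ E M) ⇔
        ((x ∈ E M × x ∈ F)
         ⊎ (∃[ k ] ∃[ f ] (k ∈ E M × k ∈ K × InV F f × x ≡ k ⊕ f)))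

Complementary : {n : ℕ} → Subset n → Subset n → Set
Complementary F K =
  (∀ x → InV F x → InV K x → x ≡ 𝟎)
  × (∀ v → ∃[ f ] ∃[ k ] (InV F f × InV K k × v ≡ f ⊕ k))

Disjoint : {n : ℕ} → Subset n → Subset n → Set
Disjoint F J = ∀ x → x ∈ F → x ∈ J → ⊥

IsMaximalDisjointFlat : {n : ℕ} → Subset n → Subset n → Set
IsMaximalDisjointFlat F J =
  IsFlat J × Disjoint F J
  × (∀ J' → IsFlat J' → Disjoint F J' → (∀ x → x ∈ J → x ∈ J')
       → ∀ x → x ∈ J' → x ∈ J)

-- Everything rests on one observation: when F has no mixed cosets, membership in E
-- is constant on each coset k + V(F) with k ∉ V(F).  For a complement K every
-- vector outside V(F) is k + f with k ∈ K, so E is the lift-join of M|F and M|K;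
-- conversely a lift-join is visibly a union of whole cosets, so it has no mixed
-- cosets.  Finally, over F₂ⁿ the complements of F are exactly the maximal flats
-- disjoint from F: a flat J with V(F) ∩ V(J) = {0} and v ∉ V(F) + V(J) extends to
-- the flat J ∪ (v + V(J)) with the same property, and a greedy pass over all
-- vectors produces a complement.
module Submission where

open import Defs
open import Data.Nat using (ℕ; zero; suc)
open import Data.Bool using (true; false)
open import Data.Bool.Properties
  using (xor-comm; xor-assoc; xor-identityˡ; xor-identityʳ; xor-same)
  renaming (_≟_ to _≟ᴮ_)
open import Data.Vec using ([]; _∷_)
open import Data.Vec.Properties
  using (≡-dec; zipWith-comm; zipWith-assoc; zipWith-identityˡ; zipWith-identityʳ)
open import Data.List using (List; []; _∷_; map; _++_)
open import Data.List.Relation.Unary.Any using (here; there; any?)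
open import Data.List.Membership.Propositional using (find; lose) renaming (_∈_ to _∈ᴸ_)
open import Data.List.Membership.Propositional.Properties using (∈-map⁺; ∈-++⁺ˡ; ∈-++⁺ʳ)
open import Data.Product using (Σ-syntax; ∃; ∃-syntax; _×_; _,_; proj₁; proj₂)
open import Data.Sum using (_⊎_; inj₁; inj₂)
open import Function.Bundles using (_⇔_; mk⇔; module Equivalence)
open import Relation.Nullary using (¬_; Dec; yes; no; contradiction)
open import Relation.Nullary.Decidable using (⌊_⌋; ¬?; _×-dec_; _⊎-dec_; map′)
open import Relation.Binary.PropositionalEquality
  using (_≡_; refl; sym; trans; cong; cong₂; subst; module ≡-Reasoning)

open Equivalence using (to; from)

private
  variable
    n : ℕ
    x y z f k v : Vect n
    S F J K : Subset n

⊕-comm : (x y : Vect n) → x ⊕ y ≡ y ⊕ x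
⊕-comm = zipWith-comm xor-comm

⊕-assoc : (x y z : Vect n) → x ⊕ y ⊕ z ≡ x ⊕ (y ⊕ z)
⊕-assoc = zipWith-assoc xor-assoc

⊕-identityˡ : (x : Vect n) → 𝟎 ⊕ x ≡ x
⊕-identityˡ = zipWith-identityˡ xor-identityˡ

⊕-identityʳ : (x : Vect n) → x ⊕ 𝟎 ≡ x
⊕-identityʳ = zipWith-identityʳ xor-identityʳ

⊕-self : (x : Vect n) → x ⊕ x ≡ 𝟎
⊕-self []      = refl
⊕-self (a ∷ x) = cong₂ _∷_ (xor-same a) (⊕-self x)

⊕-cancelʳ : (x y : Vect n) → x ⊕ y ⊕ y ≡ x
⊕-cancelʳ x y = begin
  x ⊕ y ⊕ y     ≡⟨ ⊕-assoc x y y ⟩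
  x ⊕ (y ⊕ y)   ≡⟨ cong (x ⊕_) (⊕-self y) ⟩
  x ⊕ 𝟎         ≡⟨ ⊕-identityʳ x ⟩
  x             ∎
  where open ≡-Reasoning

⊕-cancelˡ : (x y : Vect n) → x ⊕ (x ⊕ y) ≡ y
⊕-cancelˡ x y = begin
  x ⊕ (x ⊕ y)   ≡⟨ ⊕-assoc x x y ⟨
  x ⊕ x ⊕ y     ≡⟨ cong (_⊕ y) (⊕-self x) ⟩
  𝟎 ⊕ y         ≡⟨ ⊕-identityˡ y ⟩
  y             ∎
  where open ≡-Reasoning

⊕-transpose : x ≡ y ⊕ f → y ≡ x ⊕ f
⊕-transpose {y = y} {f = f} refl = sym (⊕-cancelʳ y f)

xy⊕z≡xz⊕y : (x y z : Vect n) → x ⊕ y ⊕ z ≡ x ⊕ z ⊕ y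
xy⊕z≡xz⊕y x y z = begin
  x ⊕ y ⊕ z     ≡⟨ ⊕-assoc x y z ⟩
  x ⊕ (y ⊕ z)   ≡⟨ cong (x ⊕_) (⊕-comm y z) ⟩
  x ⊕ (z ⊕ y)   ≡⟨ ⊕-assoc x z y ⟨
  x ⊕ z ⊕ y     ∎
  where open ≡-Reasoning

xz⊕yz≡x⊕y : (x y z : Vect n) → (x ⊕ z) ⊕ (y ⊕ z) ≡ x ⊕ y
xz⊕yz≡x⊕y x y z = begin
  (x ⊕ z) ⊕ (y ⊕ z)   ≡⟨ ⊕-assoc (x ⊕ z) y z ⟨
  x ⊕ z ⊕ y ⊕ z       ≡⟨ cong (_⊕ z) (xy⊕z≡xz⊕y x z y) ⟩
  x ⊕ y ⊕ z ⊕ z       ≡⟨ ⊕-cancelʳ (x ⊕ y) z ⟩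
  x ⊕ y               ∎
  where open ≡-Reasoning

_≟_ : (x y : Vect n) → Dec (x ≡ y)
_≟_ = ≡-dec _≟ᴮ_

allVects : (n : ℕ) → List (Vect n)
allVects zero    = [] ∷ []
allVects (suc n) = map (true ∷_) (allVects n) ++ map (false ∷_) (allVects n)

∈-allVects : (x : Vect n) → x ∈ᴸ allVects n
∈-allVects []          = here refl
∈-allVects (true ∷ x)  = ∈-++⁺ˡ (∈-map⁺ (true ∷_) (∈-allVects x))
∈-allVects {suc n} (false ∷ x) =
  ∈-++⁺ʳ (map (true ∷_) (allVects n)) (∈-map⁺ (false ∷_) (∈-allVects x))

anyVect? : {P : Vect n → Set} → (∀ x → Dec (P x)) → Dec (∃ P)
anyVect? {n} P? = map′ (λ p → let x , _ , px = find p in x , px)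
                       (λ (x , px) → lose (∈-allVects x) px)
                       (any? P? (allVects n))

fromDec : {P : Vect n → Set} → (∀ x → Dec (P x)) → Subset n
fromDec P? x = ⌊ P? x ⌋

∈-fromDec : {P : Vect n → Set} (P? : ∀ x → Dec (P x)) → x ∈ fromDec P? ⇔ P x
∈-fromDec {x = x} P? with P? x
... | yes px = mk⇔ (λ _ → px) (λ _ → refl)
... | no ¬px = mk⇔ (λ ()) (λ px → contradiction px ¬px)

InV? : (S : Subset n) (x : Vect n) → Dec (InV S x)
InV? S x = (x ≟ 𝟎) ⊎-dec (S x ≟ᴮ true)

_⊆_ : Subset n → Subset n → Set
S ⊆ J = ∀ x → x ∈ S → x ∈ J

⊆-refl : S ⊆ S
⊆-refl _ x∈S = x∈S

⊆-trans : S ⊆ J → J ⊆ K → S ⊆ K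
⊆-trans S⊆J J⊆K x x∈S = J⊆K x (S⊆J x x∈S)

InV-mono : S ⊆ J → InV S x → InV J x
InV-mono S⊆J (inj₁ x≡𝟎) = inj₁ x≡𝟎
InV-mono S⊆J (inj₂ x∈S) = inj₂ (S⊆J _ x∈S)

InV-intro : (InG x → x ∈ S) → InV S x
InV-intro {x = x} x∈S with x ≟ 𝟎
... | yes x≡𝟎 = inj₁ x≡𝟎
... | no x≢𝟎  = inj₂ (x∈S x≢𝟎)

InV∧nonzero⇒∈ : InG x → InV S x → x ∈ S
InV∧nonzero⇒∈ x≢𝟎 (inj₁ x≡𝟎) = contradiction x≡𝟎 x≢𝟎
InV∧nonzero⇒∈ x≢𝟎 (inj₂ x∈S) = x∈S

∉V⇒nonzero : ¬ InV S x → InG x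
∉V⇒nonzero x∉V x≡𝟎 = x∉V (inj₁ x≡𝟎)

∈flat⇒nonzero : IsFlat F → x ∈ F → InG x
∈flat⇒nonzero (𝟎∉F , _) x∈F refl = 𝟎∉F x∈F

∉V-⊕ : IsFlat F → ¬ InV F k → InV F f → ¬ InV F (k ⊕ f)
∉V-⊕ {F = F} {k = k} {f = f} (_ , closed) k∉V f∈V kf∈V =
  k∉V (subst (InV F) (⊕-cancelʳ k f) (closed (k ⊕ f) f kf∈V f∈V))

InCoset-sym : InCoset F x y → InCoset F y x
InCoset-sym (f , f∈V , y≡x⊕f) = f , f∈V , ⊕-transpose y≡x⊕f

InCoset-trans : IsFlat F → InCoset F x y → InCoset F y z → InCoset F x z
InCoset-trans {x = x} (_ , closed) (f , f∈V , refl) (g , g∈V , refl) =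
  f ⊕ g , closed f g f∈V g∈V , ⊕-assoc x f g

InCoset-InV : IsFlat F → InV F x → InCoset F x y → InV F y
InCoset-InV {x = x} (_ , closed) x∈V (f , f∈V , refl) = closed x f x∈V f∈V

Independent : Subset n → Subset n → Set
Independent F J = ∀ x → InV F x → InV J x → x ≡ 𝟎

InVSum : Subset n → Subset n → Vect n → Set
InVSum F J v = ∃[ f ] ∃[ k ] (InV F f × InV J k × v ≡ f ⊕ k)

InVSum? : (F J : Subset n) (v : Vect n) → Dec (InVSum F J v)
InVSum? F J v =
  map′ (λ (f , f∈V , fv∈V) → f , f ⊕ v , f∈V , fv∈V , sym (⊕-cancelˡ f v))
       (λ (f , k , f∈V , k∈V , v≡f⊕k) →
          f , f∈V , subst (InV J) (trans (sym (⊕-cancelˡ f k)) (cong (f ⊕_) (sym v≡f⊕k))) k∈V)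
       (anyVect? (λ f → InV? F f ×-dec InV? J (f ⊕ v)))

InVSum-mono : J ⊆ K → InVSum F J v → InVSum F K v
InVSum-mono J⊆K (f , k , f∈V , k∈V , v≡f⊕k) = f , k , f∈V , InV-mono J⊆K k∈V , v≡f⊕k

disjoint⇒independent : Disjoint F J → Independent F J
disjoint⇒independent disj x (inj₁ x≡𝟎) _            = x≡𝟎
disjoint⇒independent disj x (inj₂ _)   (inj₁ x≡𝟎)   = x≡𝟎
disjoint⇒independent disj x (inj₂ x∈F) (inj₂ x∈J)   = contradiction x∈J (disj x x∈F)

independent⇒disjoint : IsFlat F → Independent F J → Disjoint F J
independent⇒disjoint Ff indep x x∈F x∈J =
  ∈flat⇒nonzero Ff x∈F (indep x (inj₂ x∈F) (inj₂ x∈J))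

InAdjoin? : (J : Subset n) (v y : Vect n) → Dec (InG y × (InV J y ⊎ InV J (y ⊕ v)))
InAdjoin? J v y = ¬? (y ≟ 𝟎) ×-dec (InV? J y ⊎-dec InV? J (y ⊕ v))

adjoin : Subset n → Vect n → Subset n
adjoin J v = fromDec (InAdjoin? J v)

∈-adjoin : (J : Subset n) (v : Vect n) → x ∈ adjoin J v ⇔ (InG x × (InV J x ⊎ InV J (x ⊕ v)))
∈-adjoin J v = ∈-fromDec (InAdjoin? J v)

InV-adjoin⁻ : (J : Subset n) (v : Vect n) → InV (adjoin J v) x → InV J x ⊎ InV J (x ⊕ v)
InV-adjoin⁻ J v (inj₁ x≡𝟎)  = inj₁ (inj₁ x≡𝟎)
InV-adjoin⁻ J v (inj₂ x∈J′) = proj₂ (to (∈-adjoin J v) x∈J′)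

InV-adjoin⁺ : (J : Subset n) (v : Vect n) → InV J x ⊎ InV J (x ⊕ v) → InV (adjoin J v) x
InV-adjoin⁺ J v h = InV-intro {S = adjoin J v} (λ x≢𝟎 → from (∈-adjoin J v) (x≢𝟎 , h))

⊆-adjoin : IsFlat J → J ⊆ adjoin J v
⊆-adjoin {J = J} {v = v} Jf x x∈J =
  InV∧nonzero⇒∈ {S = adjoin J v} (∈flat⇒nonzero Jf x∈J) (InV-adjoin⁺ J v (inj₁ (inj₂ x∈J)))

InV-adjoin-self : (J : Subset n) (v : Vect n) → InV (adjoin J v) v
InV-adjoin-self J v = InV-adjoin⁺ J v (inj₂ (inj₁ (⊕-self v)))

adjoin-isFlat : IsFlat J → IsFlat (adjoin J v)
adjoin-isFlat {J = J} {v = v} (_ , closed) = 𝟎∉J′ , closed′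
  where
  𝟎∉J′ : ¬ 𝟎 ∈ adjoin J v
  𝟎∉J′ 𝟎∈J′ = proj₁ (to (∈-adjoin J v) 𝟎∈J′) refl

  span : ∀ x y → InV J x ⊎ InV J (x ⊕ v) → InV J y ⊎ InV J (y ⊕ v)
       → InV J (x ⊕ y) ⊎ InV J (x ⊕ y ⊕ v)
  span x y (inj₁ p) (inj₁ q) = inj₁ (closed x y p q)
  span x y (inj₁ p) (inj₂ q) = inj₂ (subst (InV J) (sym (⊕-assoc x y v)) (closed x (y ⊕ v) p q))
  span x y (inj₂ p) (inj₁ q) = inj₂ (subst (InV J) (xy⊕z≡xz⊕y x v y) (closed (x ⊕ v) y p q))
  span x y (inj₂ p) (inj₂ q) = inj₁ (subst (InV J) (xz⊕yz≡x⊕y x y v) (closed (x ⊕ v) (y ⊕ v) p q))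

  closed′ : ∀ x y → InV (adjoin J v) x → InV (adjoin J v) y → InV (adjoin J v) (x ⊕ y)
  closed′ x y p q = InV-adjoin⁺ J v (span x y (InV-adjoin⁻ J v p) (InV-adjoin⁻ J v q))

adjoin-independent : Independent F J → ¬ InVSum F J v → Independent F (adjoin J v)
adjoin-independent {J = J} {v = v} indep v∉F+J x x∈F x∈J′ with InV-adjoin⁻ J v x∈J′
... | inj₁ x∈J  = indep x x∈F x∈J
... | inj₂ xv∈J = contradiction (x , x ⊕ v , x∈F , xv∈J , sym (⊕-cancelˡ x v)) v∉F+J

record IndependentFlat (F : Subset n) : Set where
  field
    carrier     : Subset n
    isFlat      : IsFlat carrier
    independent : Independent F carrier

open IndependentFlat

∅-independentFlat : IndependentFlat F
∅-independentFlat = record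
  { carrier     = λ _ → false
  ; isFlat      = (λ ()) , closed
  ; independent = λ { _ _ (inj₁ x≡𝟎) → x≡𝟎 }
  }
  where
  closed : ∀ x y → InV (λ _ → false) x → InV (λ _ → false) y → InV (λ _ → false) (x ⊕ y)
  closed x y (inj₁ refl) (inj₁ refl) = inj₁ (⊕-self 𝟎)

grow : (J : IndependentFlat F) (v : Vect n) →
       Σ[ J′ ∈ IndependentFlat F ] (carrier J ⊆ carrier J′ × InVSum F (carrier J′) v)
grow {F = F} J v with InVSum? F (carrier J) v
... | yes v∈F+J = J , ⊆-refl , v∈F+J
... | no v∉F+J  = J′ , ⊆-adjoin (isFlat J) , v∈F+J′
  where
  J′ : IndependentFlat F
  J′ = record
    { carrier     = adjoin (carrier J) v
    ; isFlat      = adjoin-isFlat (isFlat J)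
    ; independent = adjoin-independent (independent J) v∉F+J
    }

  v∈F+J′ : InVSum F (carrier J′) v
  v∈F+J′ = 𝟎 , v , inj₁ refl , InV-adjoin-self (carrier J) v , sym (⊕-identityˡ v)

growAll : (xs : List (Vect n)) (J : IndependentFlat F) →
          Σ[ J′ ∈ IndependentFlat F ]
            (carrier J ⊆ carrier J′ × (∀ v → v ∈ᴸ xs → InVSum F (carrier J′) v))
growAll []       J = J , ⊆-refl , λ _ ()
growAll (x ∷ xs) J =
  let J₁ , J⊆J₁ , x∈F+J₁ = grow J x
      J₂ , J₁⊆J₂ , xs⊆F+J₂ = growAll xs J₁
  in J₂ , ⊆-trans J⊆J₁ J₁⊆J₂ , λ { _ (here refl) → InVSum-mono J₁⊆J₂ x∈F+J₁
                                  ; v (there v∈xs) → xs⊆F+J₂ v v∈xs }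

∃-complementary : (F : Subset n) → ∃[ K ] (IsFlat K × Complementary F K)
∃-complementary {n} F =
  let K , _ , covers = growAll (allVects n) ∅-independentFlat
  in carrier K , isFlat K , independent K , λ v → covers v (∈-allVects v)

complementary⇒maximalDisjoint : IsFlat F → IsFlat K → Complementary F K → IsMaximalDisjointFlat F K
complementary⇒maximalDisjoint {F = F} {K = K} Ff Kf (indep , covers) =
  Kf , independent⇒disjoint Ff indep , maximal
  where
  maximal : ∀ J → IsFlat J → Disjoint F J → K ⊆ J → J ⊆ K
  maximal J Jf@(_ , closed) disj K⊆J x x∈J with covers x
  ... | f , k , f∈V , k∈V , x≡f⊕k =
    InV∧nonzero⇒∈ {S = K} (∈flat⇒nonzero Jf x∈J) (subst (InV K) (sym x≡k) k∈V)
    where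
    f≡𝟎 : f ≡ 𝟎
    f≡𝟎 = disjoint⇒independent disj f f∈V
            (subst (InV J) (sym (⊕-transpose x≡f⊕k)) (closed x k (inj₂ x∈J) (InV-mono K⊆J k∈V)))
    x≡k : x ≡ k
    x≡k = trans x≡f⊕k (trans (cong (_⊕ k) f≡𝟎) (⊕-identityˡ k))

maximalDisjoint⇒complementary : IsFlat F → IsMaximalDisjointFlat F J → Complementary F J
maximalDisjoint⇒complementary {F = F} {J = J} Ff (Jf , disj , maximal) = indep , covers
  where
  indep : Independent F J
  indep = disjoint⇒independent disj
  covers : ∀ v → InVSum F J v
  covers v =
    let J′ , J⊆J′ , v∈F+J′ = grow (record { carrier = J ; isFlat = Jf ; independent = indep }) v
        J′⊆J = maximal (carrier J′) (isFlat J′) (independent⇒disjoint Ff (independent J′)) J⊆J′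
    in InVSum-mono J′⊆J v∈F+J′

InLiftJoin : Matroid n → Subset n → Subset n → Vect n → Set
InLiftJoin M F K x = (x ∈ E M × x ∈ F) ⊎ ∃[ k ] ∃[ f ] (k ∈ E M × k ∈ K × InV F f × x ≡ k ⊕ f)

E-nonzero : (M : Matroid n) → x ∈ E M → InG x
E-nonzero M x∈E refl = E⊆G M x∈E

noMixedCosets⇒∈E-⊕ : (M : Matroid n) → IsFlat F → NoMixedCosets M F →
                     ¬ InV F k → InV F f → k ∈ E M → k ⊕ f ∈ E M
noMixedCosets⇒∈E-⊕ {F = F} {k = k} {f = f} M Ff noMixed k∉V f∈V k∈E with E M (k ⊕ f) ≟ᴮ true
... | yes kf∈E = kf∈E
... | no kf∉E  = contradiction mixed (noMixed k)
  where
  mixed : IsMixedCoset M F k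
  mixed = (∉V⇒nonzero {S = F} k∉V , λ k∈F → k∉V (inj₂ k∈F))
        , (k , (𝟎 , inj₁ refl , sym (⊕-identityʳ k)) , k∈E)
        , (k ⊕ f , (f , f∈V , refl) , ∉V⇒nonzero {S = F} (∉V-⊕ Ff k∉V f∈V) , kf∉E)

noMixedCosets⇒isLiftJoinOf : (M : Matroid n) → IsFlat F → NoMixedCosets M F →
                             Complementary F K → IsLiftJoinOf M F K
noMixedCosets⇒isLiftJoinOf {F = F} {K = K} M Ff@(_ , closed) noMixed (indep , covers) x =
  mk⇔ split join
  where
  split : x ∈ E M → InLiftJoin M F K x
  split x∈E with F x ≟ᴮ true
  ... | yes x∈F = inj₁ (x∈E , x∈F)
  ... | no x∉F with covers x
  ... | f , k , f∈V , k∈V , x≡f⊕k = inj₂ (k , f , k∈E , k∈K , f∈V , x≡k⊕f)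
    where
    x≡k⊕f : x ≡ k ⊕ f
    x≡k⊕f = trans x≡f⊕k (⊕-comm f k)
    x∉V : ¬ InV F x
    x∉V (inj₁ x≡𝟎) = E-nonzero M x∈E x≡𝟎
    x∉V (inj₂ x∈F) = x∉F x∈F
    k∉V : ¬ InV F k
    k∉V k∈V′ = x∉V (subst (InV F) (sym x≡f⊕k) (closed f k f∈V k∈V′))
    k∈K : k ∈ K
    k∈K = InV∧nonzero⇒∈ {S = K} (∉V⇒nonzero {S = F} k∉V) k∈V
    k∈E : k ∈ E M
    k∈E = subst (_∈ E M) (sym (⊕-transpose x≡k⊕f))
                (noMixedCosets⇒∈E-⊕ M Ff noMixed x∉V f∈V x∈E)

  join : InLiftJoin M F K x → x ∈ E M
  join (inj₁ (x∈E , _)) = x∈E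
  join (inj₂ (k , f , k∈E , k∈K , f∈V , x≡k⊕f)) =
    subst (_∈ E M) (sym x≡k⊕f) (noMixedCosets⇒∈E-⊕ M Ff noMixed k∉V f∈V k∈E)
    where
    k∉V : ¬ InV F k
    k∉V k∈V = E-nonzero M k∈E (indep k k∈V (inj₂ k∈K))

isLiftJoinOf⇒noMixedCosets : (M : Matroid n) → IsFlat F → IsLiftJoinOf M F K → NoMixedCosets M F
isLiftJoinOf⇒noMixedCosets {F = F} M Ff liftJoin x
  ((x≢𝟎 , x∉F) , (y , x~y , y∈E) , (z , x~z , _ , z∉E))
  with to (liftJoin y) y∈E
... | inj₁ (_ , y∈F) =
  x∉F (InV∧nonzero⇒∈ {S = F} x≢𝟎 (InCoset-InV Ff (inj₂ y∈F) (InCoset-sym x~y)))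
... | inj₂ (k , f , k∈E , k∈K , k~y) =
  z∉E (from (liftJoin z) (inj₂ (k , proj₁ k~z , k∈E , k∈K , proj₂ k~z)))
  where
  k~z : InCoset F k z
  k~z = InCoset-trans Ff (f , k~y) (InCoset-trans Ff (InCoset-sym x~y) x~z)

lemma2p2 : {n : ℕ} (M : Matroid n) (F : Subset n) → IsFlat F →
    (NoMixedCosets M F
       ⇔ (∃[ K ] (IsFlat K × Complementary F K × IsLiftJoinOf M F K)))
    × ((∃[ K ] (IsFlat K × Complementary F K × IsLiftJoinOf M F K))
       ⇔ (∀ J → IsMaximalDisjointFlat F J → IsLiftJoinOf M F J))
lemma2p2 M F Ff = mk⇔ 1⇒2 2⇒1 , mk⇔ 2⇒3 3⇒2
  where
  1⇒2 : NoMixedCosets M F → ∃[ K ] (IsFlat K × Complementary F K × IsLiftJoinOf M F K)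
  1⇒2 noMixed =
    let K , Kf , K-compl = ∃-complementary F
    in K , Kf , K-compl , noMixedCosets⇒isLiftJoinOf M Ff noMixed K-compl

  2⇒1 : ∃[ K ] (IsFlat K × Complementary F K × IsLiftJoinOf M F K) → NoMixedCosets M F
  2⇒1 (_ , _ , _ , liftJoin) = isLiftJoinOf⇒noMixedCosets M Ff liftJoin

  2⇒3 : ∃[ K ] (IsFlat K × Complementary F K × IsLiftJoinOf M F K) →
        ∀ J → IsMaximalDisjointFlat F J → IsLiftJoinOf M F J
  2⇒3 liftJoin J J-max =
    noMixedCosets⇒isLiftJoinOf M Ff (2⇒1 liftJoin) (maximalDisjoint⇒complementary Ff J-max)

  3⇒2 : (∀ J → IsMaximalDisjointFlat F J → IsLiftJoinOf M F J) →
        ∃[ K ] (IsFlat K × Complementary F K × IsLiftJoinOf M F K)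
  3⇒2 liftJoins =
    let K , Kf , K-compl = ∃-complementary F
    in K , Kf , K-compl , liftJoins K (complementary⇒maximalDisjoint Ff Kf K-compl)
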